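{- Let $\mathcal{A}_H$ be the Hall affine plane of order $q^2$ and let $TR$, $ATP$, $LNR$ be the groups of collineations described in the context. (i) The group generated by $TR$ and $ATP$ acts transitively on the set of all type 2 lines and acts transitively on the set of all vertical lines. (ii) The group generated by $TR$ and $LNR$ acts transitively on the set $BF$ of all lines that are of type 1 or vertical.
   Context: Let $F=F_q$ ($q$ a prime power) and $f(x)=x^2-rx-s$, $r,s\in F$, irreducible over $F$. The Hall system is $H=F^2$ with componentwise addition and multiplication $\mathbf a\mathbf b=(a_1b_1,a_2b_1)$ if $b_2=0$, and $\mathbf a\mathbf b=(a_1b_1-a_2b_2^{ -1}f(b_1),\,a_1b_2-a_2b_1+a_2r)$ if $b_2\neq0$; $b\in F$ is identified with $(b,0)$. The Hall affine plane $\mathcal{A}_H$ has points $(\mathbf x,\mathbf y)\in H\times H$ and lines $\{(\mathbf x,\mathbf x\mathbf m+\mathbf k):\mathbf x\in H\}$ ($\mathbf m,\mathbf k\in H$; type 1 if $m_2=0$, type 2 if $m_2\neq0$) and vertical lines $\{(\mathbf c,\mathbf y):\mathbf y\in H\}$. A collineation is a bijection of the point set mapping lines onto lines. $TR=\{\tau_{\mathbf a,\mathbf b}:\mathbf a,\mathbf b\in H\}$ with $\tau_{\mathbf a,\mathbf b}(\mathbf x,\mathbf y)=(\mathbf x+\mathbf a,\mathbf y+\mathbf b)$. $ATP=\{\sigma_S:S\in GL(2,F)\}$ with $\sigma_S(\mathbf x,\mathbf y)=(\mathbf xS,\mathbf yS)$, where $\mathbf xS$ is the row vector $(x_1,x_2)$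 times the matrix $S$. $LNR=\{\lambda_{a,b}:a,b\in F,(a,b)\neq(0,0)\}$ with $\lambda_{a,b}(\mathbf x,\mathbf y)=((-ar+b)\mathbf x+a\mathbf y,\ as\,\mathbf x+b\mathbf y)$, scalars from $F$ acting componentwise on $H=F^2$. All these maps are collineations of $\mathcal{A}_H$. -}

module Defs where

open import Level using (0ℓ)
open import Data.Nat using (ℕ)
open import Data.Fin using (Fin)
open import Data.Product using (Σ; ∃; ∃-syntax; _×_; _,_)
open import Data.Sum using (_⊎_)
open import Data.Empty using (⊥)
open import Data.Unit using (⊤)
open import Function using (_∘_; id)
open import Function.Bundles using (_↔_)
open import Relation.Nullary using (¬_; Dec; yes; no)
open import Relation.Binary.PropositionalEquality using (_≡_; _≢_)
open import Algebra.Structures using (IsCommutativeRing)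

-- A finite field, with propositional equality as the equality.
-- (Every finite field has prime-power order q, so this is F_q.)
record FiniteField : Set₁ where
  infixl 6 _+_
  infixl 7 _*_
  field
    Carrier : Set
    _+_ _*_ : Carrier → Carrier → Carrier
    -_      : Carrier → Carrier
    0# 1#   : Carrier
    isCommutativeRing : IsCommutativeRing _≡_ _+_ _*_ -_ 0# 1#
    _⁻¹     : Carrier → Carrier
    ⁻¹-inverse : ∀ x → x ≢ 0# → x * (x ⁻¹) ≡ 1#
    0≢1     : 0# ≢ 1#
    _≟_     : (x y : Carrier) → Dec (x ≡ y)
    size    : ℕ
    finite  : Carrier ↔ Fin size

  infixl 6 _-_
  _-_ : Carrier → Carrier → Carrier
  x - y = x + (- y)

-- f(x) = x² - r x - s is irreducible over F: it is not a product of two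
-- polynomials of degree 1, (a x + b)(c x + d), a ≠ 0, c ≠ 0
-- (comparing coefficients of x², x, 1).
Irreducible : (F : FiniteField) → FiniteField.Carrier F → FiniteField.Carrier F → Set
Irreducible F r s =
  ¬ (Σ Carrier λ a → Σ Carrier λ b → Σ Carrier λ c → Σ Carrier λ d →
       a ≢ 0# × c ≢ 0# × (a * c) ≡ 1# × ((a * d) + (b * c)) ≡ (- r) × (b * d) ≡ (- s))
  where open FiniteField F

module Hall (F : FiniteField) (r s : FiniteField.Carrier F) where
  open FiniteField F

  f : Carrier → Carrier
  f t = ((t * t) - (r * t)) - s

  H : Set
  H = Carrier × Carrier

  _⊕_ : H → H → H
  (a₁ , a₂) ⊕ (b₁ , b₂) = (a₁ + b₁ , a₂ + b₂)

  _⊗_ : H → H → H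
  (a₁ , a₂) ⊗ (b₁ , b₂) with b₂ ≟ 0#
  ... | yes _ = (a₁ * b₁ , a₂ * b₁)
  ... | no  _ = ((a₁ * b₁) - ((a₂ * (b₂ ⁻¹)) * f b₁) , ((a₁ * b₂) - (a₂ * b₁)) + (a₂ * r))

  _·_ : Carrier → H → H
  c · (x₁ , x₂) = (c * x₁ , c * x₂)

  Point : Set
  Point = H × H

  data Line : Set where
    nonvert : (m k : H) → Line
    vert    : (c : H) → Line

  _∈L_ : Point → Line → Set
  (x , y) ∈L nonvert m k = y ≡ ((x ⊗ m) ⊕ k)
  (x , y) ∈L vert c      = x ≡ c

  Type1 : Line → Set
  Type1 (nonvert (m₁ , m₂) k) = m₂ ≡ 0#
  Type1 (vert c)              = ⊥

  Type2 : Line → Set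
  Type2 (nonvert (m₁ , m₂) k) = m₂ ≢ 0#
  Type2 (vert c)              = ⊥

  Vertical : Line → Set
  Vertical (nonvert m k) = ⊥
  Vertical (vert c)      = ⊤

  BF : Line → Set
  BF ℓ = Type1 ℓ ⊎ Vertical ℓ

  τ : H → H → Point → Point
  τ a b (x , y) = (x ⊕ a , y ⊕ b)

  record Mat : Set where
    constructor mat
    field s₁₁ s₁₂ s₂₁ s₂₂ : Carrier

  det : Mat → Carrier
  det (mat a b c d) = (a * d) - (b * c)

  _⋆_ : H → Mat → H
  (x₁ , x₂) ⋆ mat a b c d = ((x₁ * a) + (x₂ * c) , (x₁ * b) + (x₂ * d))

  σ : Mat → Point → Point
  σ S (x , y) = (x ⋆ S , y ⋆ S)

  λ' : Carrier → Carrier → Point → Point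
  λ' a b (x , y) = (((((- (a * r)) + b) · x) ⊕ (a · y) , ((a * s) · x) ⊕ (b · y)))

  IsTR : (Point → Point) → Set
  IsTR g = ∃[ a ] ∃[ b ] (∀ p → g p ≡ τ a b p)

  IsATP : (Point → Point) → Set
  IsATP g = ∃[ S ] (det S ≢ 0# × (∀ p → g p ≡ σ S p))

  IsLNR : (Point → Point) → Set
  IsLNR g = ∃[ a ] ∃[ b ] (¬ (a ≡ 0# × b ≡ 0#) × (∀ p → g p ≡ λ' a b p))

  data Gen (P : (Point → Point) → Set) : (Point → Point) → Set where
    gen-id  : Gen P id
    gen-gen : ∀ {g h} → P g → Gen P h → Gen P (g ∘ h)
    gen-inv : ∀ {g g' h} → P g → (∀ p → g (g' p) ≡ p) → (∀ p → g' (g p) ≡ p)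
              → Gen P h → Gen P (g' ∘ h)

  MapsOnto : (Point → Point) → Line → Line → Set
  MapsOnto g ℓ ℓ' = ∀ p → ((∃[ q ] (q ∈L ℓ × g q ≡ p)) → p ∈L ℓ')
                        × (p ∈L ℓ' → ∃[ q ] (q ∈L ℓ × g q ≡ p))

  TransitiveOn : ((Point → Point) → Set) → (Line → Set) → Set
  TransitiveOn G S = ∀ ℓ ℓ' → S ℓ → S ℓ' → ∃[ g ] (G g × MapsOnto g ℓ ℓ')

  ⟨TR,ATP⟩ : (Point → Point) → Set
  ⟨TR,ATP⟩ = Gen (λ g → IsTR g ⊎ IsATP g)

  ⟨TR,LNR⟩ : (Point → Point) → Set
  ⟨TR,LNR⟩ = Gen (λ g → IsTR g ⊎ IsLNR g)

{-# OPTIONS --safe #-}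

-- A translation moves a line to any parallel line, so it suffices to connect slopes.
-- For type 2 slopes m and n, the F-linear map S of H = F² fixing (1, 0) and sending m
-- to n satisfies (x m) S = (x S) n, so σ_S maps y = x m + k onto y = x n + k S.
-- For a type 1 slope m ∈ F, λ_{1, r - m} sends the point (x, x m) to (0, - f(m) x);
-- as the irreducible f has no root, this maps y = x m onto the vertical line x = 0,
-- which λ_{1, n} in turn maps onto y = x n.
module Submission where

open import Defs
open import Level using (0ℓ)
open import Data.Integer.Base using (+_)
open import Data.Product using (_×_; _,_; proj₁; proj₂)
open import Data.Sum using (_⊎_; inj₁; inj₂)
open import Data.Empty using (⊥-elim)
open import Function using (_∘_; id)
open import Relation.Nullary using (yes; no)
open import Relation.Binary.PropositionalEquality
  using (_≡_; _≢_; refl; sym; trans; cong; cong₂; subst; module ≡-Reasoning)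
open import Algebra.Bundles using (CommutativeRing)
import Relation.Binary.Reasoning.Base.Single

-- Coefficients must have an equality that computes for the ring solver to cancel
-- terms; the integers, which map into every commutative ring, provide them.
module IntegerCoefficientSolver {c ℓ} (R : CommutativeRing c ℓ) where
  open import Data.Nat.Base as ℕ using (zero; suc)
  import Data.Nat.Properties as ℕ
  open import Data.Integer.Base as ℤ using (ℤ; +_; -[1+_]; _⊖_; sign; ∣_∣; _◃_)
  import Data.Integer.Properties as ℤ using ([1+m]⊖[1+n]≡m⊖n; _≟_)
  open import Data.Sign.Base as Sign using (Sign)
  open import Data.Maybe.Base using (Maybe; just; nothing)
  open import Algebra.Solver.Ring.AlmostCommutativeRing
    using (fromCommutativeRing; _-Raw-AlmostCommutative⟶_)
  open CommutativeRing R renaming (refl to ≈-refl; sym to ≈-sym; trans to ≈-trans)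
  open import Algebra.Properties.Ring ring using (-0#≈0#; -‿involutive; -‿+-comm; -1*x≈-x)
  open import Algebra.Properties.Semiring.Mult.TCOptimised semiring
    using (1+×; ×-homo-+; ×1-homo-*) renaming (_×_ to _×′_)
  open import Algebra.Properties.CommutativeSemigroup +-commutativeSemigroup as +-CS using ()
  open import Algebra.Properties.CommutativeSemigroup *-commutativeSemigroup as *-CS using ()
  open import Relation.Binary.Reasoning.Setoid setoid

  ⟦_⟧ℤ : ℤ → Carrier
  ⟦ + n ⟧ℤ      = n ×′ 1#
  ⟦ -[1+ n ] ⟧ℤ = - (suc n ×′ 1#)

  [x+y]-[x+z]≈y-z : ∀ x y z → (x + y) - (x + z) ≈ y - z
  [x+y]-[x+z]≈y-z x y z = begin
    (x + y) - (x + z)       ≈⟨ +-congˡ (-‿+-comm x z) ⟨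
    (x + y) + (- x + - z)   ≈⟨ +-CS.interchange x y (- x) (- z) ⟩
    (x - x) + (y - z)       ≈⟨ +-congʳ (-‿inverseʳ x) ⟩
    0# + (y - z)            ≈⟨ +-identityˡ (y - z) ⟩
    y - z                   ∎

  ⟦⊖⟧ : ∀ m n → ⟦ m ⊖ n ⟧ℤ ≈ m ×′ 1# - n ×′ 1#
  ⟦⊖⟧ m       zero    = ≈-sym (≈-trans (+-congˡ -0#≈0#) (+-identityʳ _))
  ⟦⊖⟧ zero    (suc n) = ≈-sym (+-identityˡ _)
  ⟦⊖⟧ (suc m) (suc n) = begin
    ⟦ suc m ⊖ suc n ⟧ℤ               ≡⟨ cong ⟦_⟧ℤ (ℤ.[1+m]⊖[1+n]≡m⊖n m n) ⟩
    ⟦ m ⊖ n ⟧ℤ                       ≈⟨ ⟦⊖⟧ m n ⟩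
    m ×′ 1# - n ×′ 1#                ≈⟨ [x+y]-[x+z]≈y-z 1# (m ×′ 1#) (n ×′ 1#) ⟨
    (1# + m ×′ 1#) - (1# + n ×′ 1#)  ≈⟨ +-cong (1+× m 1#) (-‿cong (1+× n 1#)) ⟨
    suc m ×′ 1# - suc n ×′ 1#        ∎

  ⟦⟧-homo-+ : ∀ i j → ⟦ i ℤ.+ j ⟧ℤ ≈ ⟦ i ⟧ℤ + ⟦ j ⟧ℤ
  ⟦⟧-homo-+ (+ m)    (+ n)    = ×-homo-+ 1# m n
  ⟦⟧-homo-+ (+ m)    -[1+ n ] = ⟦⊖⟧ m (suc n)
  ⟦⟧-homo-+ -[1+ m ] (+ n)    = ≈-trans (⟦⊖⟧ n (suc m)) (+-comm _ _)
  ⟦⟧-homo-+ -[1+ m ] -[1+ n ] = begin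
    - (suc (suc (m ℕ.+ n)) ×′ 1#)      ≡⟨ cong (λ k → - (suc k ×′ 1#)) (ℕ.+-suc m n) ⟨
    - ((suc m ℕ.+ suc n) ×′ 1#)        ≈⟨ -‿cong (×-homo-+ 1# (suc m) (suc n)) ⟩
    - (suc m ×′ 1# + suc n ×′ 1#)      ≈⟨ -‿+-comm _ _ ⟨
    - (suc m ×′ 1#) + - (suc n ×′ 1#)  ∎

  ⟦_⟧Sign : Sign → Carrier
  ⟦ Sign.+ ⟧Sign = 1#
  ⟦ Sign.- ⟧Sign = - 1#

  ⟦⟧Sign-homo-* : ∀ s t → ⟦ s Sign.* t ⟧Sign ≈ ⟦ s ⟧Sign * ⟦ t ⟧Sign
  ⟦⟧Sign-homo-* Sign.+ t      = ≈-sym (*-identityˡ _)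
  ⟦⟧Sign-homo-* Sign.- Sign.+ = ≈-sym (*-identityʳ _)
  ⟦⟧Sign-homo-* Sign.- Sign.- = ≈-sym (≈-trans (-1*x≈-x (- 1#)) (-‿involutive 1#))

  ⟦◃⟧ : ∀ s n → ⟦ s ◃ n ⟧ℤ ≈ ⟦ s ⟧Sign * (n ×′ 1#)
  ⟦◃⟧ s      zero    = ≈-sym (zeroʳ _)
  ⟦◃⟧ Sign.+ (suc n) = ≈-sym (*-identityˡ _)
  ⟦◃⟧ Sign.- (suc n) = ≈-sym (-1*x≈-x _)

  ⟦⟧≈sign*abs : ∀ i → ⟦ i ⟧ℤ ≈ ⟦ sign i ⟧Sign * (∣ i ∣ ×′ 1#)
  ⟦⟧≈sign*abs (+ n)    = ≈-sym (*-identityˡ _)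
  ⟦⟧≈sign*abs -[1+ n ] = ≈-sym (-1*x≈-x _)

  ⟦⟧-homo-* : ∀ i j → ⟦ i ℤ.* j ⟧ℤ ≈ ⟦ i ⟧ℤ * ⟦ j ⟧ℤ
  ⟦⟧-homo-* i j = begin
    ⟦ (sign i Sign.* sign j) ◃ (∣ i ∣ ℕ.* ∣ j ∣) ⟧ℤ
      ≈⟨ ⟦◃⟧ (sign i Sign.* sign j) (∣ i ∣ ℕ.* ∣ j ∣) ⟩
    ⟦ sign i Sign.* sign j ⟧Sign * ((∣ i ∣ ℕ.* ∣ j ∣) ×′ 1#)
      ≈⟨ *-cong (⟦⟧Sign-homo-* (sign i) (sign j)) (×1-homo-* ∣ i ∣ ∣ j ∣) ⟩
    (⟦ sign i ⟧Sign * ⟦ sign j ⟧Sign) * (∣ i ∣ ×′ 1# * ∣ j ∣ ×′ 1#)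
      ≈⟨ *-CS.interchange _ _ _ _ ⟩
    (⟦ sign i ⟧Sign * ∣ i ∣ ×′ 1#) * (⟦ sign j ⟧Sign * ∣ j ∣ ×′ 1#)
      ≈⟨ *-cong (⟦⟧≈sign*abs i) (⟦⟧≈sign*abs j) ⟨
    ⟦ i ⟧ℤ * ⟦ j ⟧ℤ
      ∎

  ⟦⟧-homo-‿ : ∀ i → ⟦ ℤ.- i ⟧ℤ ≈ - ⟦ i ⟧ℤ
  ⟦⟧-homo-‿ (+ zero)  = ≈-sym -0#≈0#
  ⟦⟧-homo-‿ (+ suc n) = ≈-refl
  ⟦⟧-homo-‿ -[1+ n ]  = ≈-sym (-‿involutive _)

  homomorphism : ℤ.+-*-rawRing -Raw-AlmostCommutative⟶ fromCommutativeRing R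
  homomorphism = record
    { ⟦_⟧    = ⟦_⟧ℤ
    ; +-homo = ⟦⟧-homo-+
    ; *-homo = ⟦⟧-homo-*
    ; -‿homo = ⟦⟧-homo-‿
    ; 0-homo = ≈-refl
    ; 1-homo = ≈-refl
    }

  ⟦⟧-≟ : ∀ i j → Maybe (⟦ i ⟧ℤ ≈ ⟦ j ⟧ℤ)
  ⟦⟧-≟ i j with i ℤ.≟ j
  ... | yes refl = just ≈-refl
  ... | no _       = nothing

  open import Algebra.Solver.Ring ℤ.+-*-rawRing (fromCommutativeRing R) homomorphism ⟦⟧-≟ public

module FieldFacts (F : FiniteField) where
  open FiniteField F

  commutativeRing : CommutativeRing 0ℓ 0ℓ
  commutativeRing = record { isCommutativeRing = isCommutativeRing }

  open CommutativeRing commutativeRing public using (*-identityˡ; *-assoc; zeroʳ)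
  open IntegerCoefficientSolver commutativeRing public
    using (solve; _:=_; _:+_; _:-_; _:*_; :-_; con; Polynomial)
  open ≡-Reasoning

  𝟘 𝟙 : ∀ {n} → Polynomial n
  𝟘 = con (+ 0)
  𝟙 = con (+ 1)

  1≢0 : 1# ≢ 0#
  1≢0 = 0≢1 ∘ sym

  -‿≢0 : ∀ {x} → x ≢ 0# → - x ≢ 0#
  -‿≢0 {x} x≢0 -x≡0 = x≢0 (begin
    x        ≡⟨ solve 1 (λ x → x := :- (:- x)) refl x ⟩
    - (- x)  ≡⟨ cong -_ -x≡0 ⟩
    - 0#     ≡⟨ solve 0 (:- 𝟘 := 𝟘) refl ⟩
    0#       ∎)

  ⁻¹-≢0 : ∀ {x} → x ≢ 0# → x ⁻¹ ≢ 0#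
  ⁻¹-≢0 {x} x≢0 x⁻¹≡0 = 0≢1 (begin
    0#        ≡⟨ zeroʳ x ⟨
    x * 0#    ≡⟨ cong (x *_) x⁻¹≡0 ⟨
    x * x ⁻¹  ≡⟨ ⁻¹-inverse x x≢0 ⟩
    1#        ∎)

  x*[x⁻¹*y]≡y : ∀ {x} → x ≢ 0# → ∀ y → x * (x ⁻¹ * y) ≡ y
  x*[x⁻¹*y]≡y {x} x≢0 y = begin
    x * (x ⁻¹ * y)  ≡⟨ *-assoc x (x ⁻¹) y ⟨
    x * x ⁻¹ * y    ≡⟨ cong (_* y) (⁻¹-inverse x x≢0) ⟩
    1# * y          ≡⟨ *-identityˡ y ⟩
    y               ∎

  *-≢0 : ∀ {x y} → x ≢ 0# → y ≢ 0# → x * y ≢ 0#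
  *-≢0 {x} {y} x≢0 y≢0 xy≡0 = y≢0 (begin
    y               ≡⟨ x*[x⁻¹*y]≡y x≢0 y ⟨
    x * (x ⁻¹ * y)  ≡⟨ solve 3 (λ x x⁻¹ y → x :* (x⁻¹ :* y) := x⁻¹ :* (x :* y)) refl x (x ⁻¹) y ⟩
    x ⁻¹ * (x * y)  ≡⟨ cong (x ⁻¹ *_) xy≡0 ⟩
    x ⁻¹ * 0#       ≡⟨ zeroʳ (x ⁻¹) ⟩
    0#              ∎)

  -- The solver knows nothing about _⁻¹: an identity that needs e₁ ≡ 1# and e₂ ≡ 1#,
  -- each eᵢ a product u * u ⁻¹, is proved polynomially up to multiples of eᵢ - 1#.
  ≡-modulo-units : ∀ {a b e₁ e₂ c₁ c₂} → e₁ ≡ 1# → e₂ ≡ 1# →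
                   a ≡ b + ((e₁ - 1#) * c₁ + (e₂ - 1#) * c₂) → a ≡ b
  ≡-modulo-units {b = b} {c₁ = c₁} {c₂ = c₂} refl refl a≡ =
    trans a≡ (solve 3 (λ b c₁ c₂ → b :+ ((𝟙 :- 𝟙) :* c₁ :+ (𝟙 :- 𝟙) :* c₂) := b) refl b c₁ c₂)

module HallSystem (F : FiniteField) (r s : FiniteField.Carrier F) where
  open FiniteField F
  open FieldFacts F
  open Hall F r s

  fₚ : ∀ {n} → Polynomial n → Polynomial n → Polynomial n → Polynomial n
  fₚ r s t = t :* t :- r :* t :- s

  f-root-free : Irreducible F r s → ∀ m → f m ≢ 0#
  f-root-free irr m fm≡0 =
    irr (1# , - m , 1# , m - r , 1≢0 , 1≢0 , *-identityˡ 1# , linear , constant)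
    where
    linear : 1# * (m - r) + - m * 1# ≡ - r
    linear = solve 2 (λ m r → 𝟙 :* (m :- r) :+ :- m :* 𝟙 := :- r) refl m r
    constant : - m * (m - r) ≡ - s
    constant = begin
      - m * (m - r)  ≡⟨ solve 3 (λ m r s → :- m :* (m :- r) := :- s :- fₚ r s m) refl m r s ⟩
      - s - f m      ≡⟨ cong (λ t → - s - t) fm≡0 ⟩
      - s - 0#       ≡⟨ solve 1 (λ s → :- s :- 𝟘 := :- s) refl s ⟩
      - s            ∎
      where open ≡-Reasoning

  ⊗-type1 : ∀ x₁ x₂ m₁ → (x₁ , x₂) ⊗ (m₁ , 0#) ≡ (x₁ * m₁ , x₂ * m₁)
  ⊗-type1 x₁ x₂ m₁ with 0# ≟ 0#
  ... | yes _  = refl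
  ... | no 0≢0 = ⊥-elim (0≢0 refl)

  ⊗-type2 : ∀ x₁ x₂ m₁ m₂ → m₂ ≢ 0# →
            (x₁ , x₂) ⊗ (m₁ , m₂) ≡ (x₁ * m₁ - x₂ * m₂ ⁻¹ * f m₁ , x₁ * m₂ - x₂ * m₁ + x₂ * r)
  ⊗-type2 x₁ x₂ m₁ m₂ m₂≢0 with m₂ ≟ 0#
  ... | yes m₂≡0 = ⊥-elim (m₂≢0 m₂≡0)
  ... | no _     = refl

  0H : H
  0H = 0# , 0#

  infixl 6 _⊖_
  _⊖_ : H → H → H
  (a₁ , a₂) ⊖ (b₁ , b₂) = a₁ - b₁ , a₂ - b₂

  ⊕-identityʳ : ∀ x → x ⊕ 0H ≡ x
  ⊕-identityʳ (x₁ , x₂) = cong₂ _,_ (identityʳ x₁) (identityʳ x₂)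
    where
    identityʳ : ∀ x → x + 0# ≡ x
    identityʳ = solve 1 (λ x → x :+ 𝟘 := x) refl

  ⊕-⊖-cancel : ∀ a b → a ⊕ (b ⊖ a) ≡ b
  ⊕-⊖-cancel (a₁ , a₂) (b₁ , b₂) = cong₂ _,_ (cancel a₁ b₁) (cancel a₂ b₂)
    where
    cancel : ∀ a b → a + (b - a) ≡ b
    cancel = solve 2 (λ a b → a :+ (b :- a) := b) refl

  ⊕-⊖-shift : ∀ x a b → (x ⊕ a) ⊕ (b ⊖ a) ≡ x ⊕ b
  ⊕-⊖-shift (x₁ , x₂) (a₁ , a₂) (b₁ , b₂) = cong₂ _,_ (shift x₁ a₁ b₁) (shift x₂ a₂ b₂)
    where
    shift : ∀ x a b → x + a + (b - a) ≡ x + b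
    shift = solve 3 (λ x a b → x :+ a :+ (b :- a) := x :+ b) refl

  ⋆-distribʳ-⊕ : ∀ x y S → (x ⊕ y) ⋆ S ≡ (x ⋆ S) ⊕ (y ⋆ S)
  ⋆-distribʳ-⊕ (x₁ , x₂) (y₁ , y₂) (mat a b c d) = cong₂ _,_ (distrib a c) (distrib b d)
    where
    distrib : ∀ a c → (x₁ + y₁) * a + (x₂ + y₂) * c ≡ x₁ * a + x₂ * c + (y₁ * a + y₂ * c)
    distrib = solve 6 (λ x₁ x₂ y₁ y₂ a c →
      (x₁ :+ y₁) :* a :+ (x₂ :+ y₂) :* c := x₁ :* a :+ x₂ :* c :+ (y₁ :* a :+ y₂ :* c)) refl x₁ x₂ y₁ y₂

  ·-⁻¹-cancel : ∀ {c} → c ≢ 0# → ∀ y → c · ((c ⁻¹) · y) ≡ y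
  ·-⁻¹-cancel c≢0 (y₁ , y₂) = cong₂ _,_ (x*[x⁻¹*y]≡y c≢0 y₁) (x*[x⁻¹*y]≡y c≢0 y₂)

module HallPlane (F : FiniteField) (r s : FiniteField.Carrier F) where
  open FiniteField F
  open FieldFacts F
  open Hall F r s
  open HallSystem F r s

  MapsInto : (Point → Point) → Line → Line → Set
  MapsInto g ℓ ℓ' = ∀ p → p ∈L ℓ → g p ∈L ℓ'

  mapsOnto : ∀ {g ℓ ℓ'} (h : Point → Point) → MapsInto g ℓ ℓ' → MapsInto h ℓ' ℓ →
             (∀ p → p ∈L ℓ' → g (h p) ≡ p) → MapsOnto g ℓ ℓ'
  mapsOnto {g} {ℓ' = ℓ'} h g-into h-into g∘h≡id p =
    (λ { (q , q∈ℓ , gq≡p) → subst (_∈L ℓ') gq≡p (g-into q q∈ℓ) }) ,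
    (λ p∈ℓ' → h p , h-into p p∈ℓ' , g∘h≡id p p∈ℓ')

  mapsOnto-∘ : ∀ {g h ℓ₁ ℓ₂ ℓ₃} → MapsOnto g ℓ₁ ℓ₂ → MapsOnto h ℓ₂ ℓ₃ → MapsOnto (h ∘ g) ℓ₁ ℓ₃
  mapsOnto-∘ {g} {h} g-onto h-onto p =
    (λ { (q , q∈ℓ₁ , hgq≡p) →
           proj₁ (h-onto p) (g q , proj₁ (g-onto (g q)) (q , q∈ℓ₁ , refl) , hgq≡p) }) ,
    (λ p∈ℓ₃ → let (q′ , q′∈ℓ₂ , hq′≡p) = proj₂ (h-onto p) p∈ℓ₃
                  (q , q∈ℓ₁ , gq≡q′)   = proj₂ (g-onto q′) q′∈ℓ₂
              in q , q∈ℓ₁ , trans (cong h gq≡q′) hq′≡p)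

  Gen-∘ : ∀ {P g h} → Gen P g → Gen P h → Gen P (g ∘ h)
  Gen-∘ gen-id                     Gh = Gh
  Gen-∘ (gen-gen Pg Gg)            Gh = gen-gen Pg (Gen-∘ Gg Gh)
  Gen-∘ (gen-inv Pg g∘g′ g′∘g Gg) Gh = gen-inv Pg g∘g′ g′∘g (Gen-∘ Gg Gh)

  record Reach (P : (Point → Point) → Set) (ℓ ℓ' : Line) : Set where
    constructor reach
    field
      map       : Point → Point
      generated : Gen P map
      onto      : MapsOnto map ℓ ℓ'

  reach-refl : ∀ {P ℓ} → Reach P ℓ ℓ
  reach-refl = reach id gen-id (mapsOnto id (λ _ p∈ℓ → p∈ℓ) (λ _ p∈ℓ → p∈ℓ) (λ _ _ → refl))

  reach-trans : ∀ {P ℓ₁ ℓ₂ ℓ₃} → Reach P ℓ₁ ℓ₂ → Reach P ℓ₂ ℓ₃ → Reach P ℓ₁ ℓ₃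
  reach-trans (reach g Gg g-onto) (reach h Gh h-onto) =
    reach (h ∘ g) (Gen-∘ Gh Gg) (mapsOnto-∘ g-onto h-onto)

  reach-by : ∀ {P g ℓ ℓ'} → P g → MapsOnto g ℓ ℓ' → Reach P ℓ ℓ'
  reach-by Pg g-onto = reach _ (gen-gen Pg gen-id) g-onto

  module ReachReasoning {P : (Point → Point) → Set} =
    Relation.Binary.Reasoning.Base.Single (Reach P) reach-refl reach-trans

  transitiveOn : ∀ {P S} → (∀ ℓ ℓ' → S ℓ → S ℓ' → Reach P ℓ ℓ') → TransitiveOn (Gen P) S
  transitiveOn reachable ℓ ℓ' Sℓ Sℓ' =
    let reach g Gg g-onto = reachable ℓ ℓ' Sℓ Sℓ' in g , Gg , g-onto

  isTR-τ : ∀ a b → IsTR (τ a b)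
  isTR-τ a b = a , b , λ _ → refl

  τ-nonvert : ∀ m k k' → MapsOnto (τ 0H (k' ⊖ k)) (nonvert m k) (nonvert m k')
  τ-nonvert m k k' = mapsOnto {ℓ = nonvert m k} {ℓ' = nonvert m k'} h into (λ _ _ → refl) section
    where
    h : Point → Point
    h (x , _) = x , (x ⊗ m) ⊕ k
    into : MapsInto (τ 0H (k' ⊖ k)) (nonvert m k) (nonvert m k')
    into (x , _) refl = begin
      ((x ⊗ m) ⊕ k) ⊕ (k' ⊖ k)  ≡⟨ ⊕-⊖-shift (x ⊗ m) k k' ⟩
      (x ⊗ m) ⊕ k'              ≡⟨ cong (λ x → (x ⊗ m) ⊕ k') (⊕-identityʳ x) ⟨
      ((x ⊕ 0H) ⊗ m) ⊕ k'       ∎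
      where open ≡-Reasoning
    section : ∀ p → p ∈L nonvert m k' → τ 0H (k' ⊖ k) (h p) ≡ p
    section (x , _) refl = cong₂ _,_ (⊕-identityʳ x) (⊕-⊖-shift (x ⊗ m) k k')

  τ-vert : ∀ c c' → MapsOnto (τ (c' ⊖ c) 0H) (vert c) (vert c')
  τ-vert c c' =
    mapsOnto {ℓ = vert c} {ℓ' = vert c'} (λ (_ , y) → c , y)
      (λ { _ refl → ⊕-⊖-cancel c c' })
      (λ _ _ → refl)
      (λ { (_ , y) refl → cong₂ _,_ (⊕-⊖-cancel c c') (⊕-identityʳ y) })

  Intertwines : Mat → H → H → Set
  Intertwines S m n = ∀ x → (x ⊗ m) ⋆ S ≡ (x ⋆ S) ⊗ n

  σ-mapsInto : ∀ {S m n} → Intertwines S m n →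
               ∀ k → MapsInto (σ S) (nonvert m k) (nonvert n (k ⋆ S))
  σ-mapsInto {S} {m} {n} S-intertwines k (x , _) refl = begin
    ((x ⊗ m) ⊕ k) ⋆ S        ≡⟨ ⋆-distribʳ-⊕ (x ⊗ m) k S ⟩
    ((x ⊗ m) ⋆ S) ⊕ (k ⋆ S)  ≡⟨ cong (_⊕ (k ⋆ S)) (S-intertwines x) ⟩
    ((x ⋆ S) ⊗ n) ⊕ (k ⋆ S)  ∎
    where open ≡-Reasoning

  σ-mapsOnto : ∀ {S T m n} → Intertwines S m n → Intertwines T n m →
               (∀ z → (z ⋆ S) ⋆ T ≡ z) → (∀ z → (z ⋆ T) ⋆ S ≡ z) →
               ∀ k → MapsOnto (σ S) (nonvert m k) (nonvert n (k ⋆ S))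
  σ-mapsOnto {S} {T} {m} {n} S-intertwines T-intertwines S⋆T≡id T⋆S≡id k =
    mapsOnto {ℓ = nonvert m k} {ℓ' = nonvert n (k ⋆ S)} (σ T)
      (σ-mapsInto S-intertwines k)
      (subst (MapsInto (σ T) (nonvert n (k ⋆ S)) ∘ nonvert m) (S⋆T≡id k)
        (σ-mapsInto T-intertwines (k ⋆ S)))
      (λ (x , y) _ → cong₂ _,_ (T⋆S≡id x) (T⋆S≡id y))

  Smat : H → H → Mat
  Smat (m₁ , m₂) (n₁ , n₂) = mat 1# 0# ((n₁ - m₁) * m₂ ⁻¹) (n₂ * m₂ ⁻¹)

  Smat-intertwines : ∀ {m₁ m₂ n₁ n₂} → m₂ ≢ 0# → n₂ ≢ 0# →
                     Intertwines (Smat (m₁ , m₂) (n₁ , n₂)) (m₁ , m₂) (n₁ , n₂)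
  Smat-intertwines {m₁} {m₂} {n₁} {n₂} m₂≢0 n₂≢0 (x₁ , x₂) =
    trans (cong (_⋆ Smat (m₁ , m₂) (n₁ , n₂)) (⊗-type2 x₁ x₂ m₁ m₂ m₂≢0))
      (trans (cong₂ _,_
        (≡-modulo-units (⁻¹-inverse m₂ m₂≢0) (⁻¹-inverse n₂ n₂≢0)
          (solve 10 (λ x₁ x₂ m₁ m₂ n₁ n₂ u v r s →
             (x₁ :* m₁ :- x₂ :* u :* fₚ r s m₁) :* 𝟙 :+ (x₁ :* m₂ :- x₂ :* m₁ :+ x₂ :* r) :* ((n₁ :- m₁) :* u)
             := (x₁ :* 𝟙 :+ x₂ :* ((n₁ :- m₁) :* u)) :* n₁ :- (x₁ :* 𝟘 :+ x₂ :* (n₂ :* u)) :* v :* fₚ r s n₁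
                :+ ((m₂ :* u :- 𝟙) :* (x₁ :* (n₁ :- m₁)) :+ (n₂ :* v :- 𝟙) :* (x₂ :* u :* fₚ r s n₁)))
             refl x₁ x₂ m₁ m₂ n₁ n₂ (m₂ ⁻¹) (n₂ ⁻¹) r s))
        (≡-modulo-units (⁻¹-inverse m₂ m₂≢0) (⁻¹-inverse n₂ n₂≢0)
          (solve 10 (λ x₁ x₂ m₁ m₂ n₁ n₂ u v r s →
             (x₁ :* m₁ :- x₂ :* u :* fₚ r s m₁) :* 𝟘 :+ (x₁ :* m₂ :- x₂ :* m₁ :+ x₂ :* r) :* (n₂ :* u)
             := (x₁ :* 𝟙 :+ x₂ :* ((n₁ :- m₁) :* u)) :* n₂ :- (x₁ :* 𝟘 :+ x₂ :* (n₂ :* u)) :* n₁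
                  :+ (x₁ :* 𝟘 :+ x₂ :* (n₂ :* u)) :* r
                :+ ((m₂ :* u :- 𝟙) :* (x₁ :* n₂) :+ (n₂ :* v :- 𝟙) :* 𝟘))
             refl x₁ x₂ m₁ m₂ n₁ n₂ (m₂ ⁻¹) (n₂ ⁻¹) r s)))
      (sym (⊗-type2 _ _ n₁ n₂ n₂≢0)))

  Smat-inverse : ∀ {m₁ m₂ n₁ n₂} → m₂ ≢ 0# → n₂ ≢ 0# →
                 ∀ z → (z ⋆ Smat (m₁ , m₂) (n₁ , n₂)) ⋆ Smat (n₁ , n₂) (m₁ , m₂) ≡ z
  Smat-inverse {m₁} {m₂} {n₁} {n₂} m₂≢0 n₂≢0 (z₁ , z₂) = cong₂ _,_
    (≡-modulo-units (⁻¹-inverse m₂ m₂≢0) (⁻¹-inverse n₂ n₂≢0)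
      (solve 8 (λ z₁ z₂ m₁ m₂ n₁ n₂ u v →
         (z₁ :* 𝟙 :+ z₂ :* ((n₁ :- m₁) :* u)) :* 𝟙 :+ (z₁ :* 𝟘 :+ z₂ :* (n₂ :* u)) :* ((m₁ :- n₁) :* v)
         := z₁ :+ ((m₂ :* u :- 𝟙) :* 𝟘 :+ (n₂ :* v :- 𝟙) :* (:- (z₂ :* ((n₁ :- m₁) :* u)))))
         refl z₁ z₂ m₁ m₂ n₁ n₂ (m₂ ⁻¹) (n₂ ⁻¹)))
    (≡-modulo-units (⁻¹-inverse m₂ m₂≢0) (⁻¹-inverse n₂ n₂≢0)
      (solve 8 (λ z₁ z₂ m₁ m₂ n₁ n₂ u v →
         (z₁ :* 𝟙 :+ z₂ :* ((n₁ :- m₁) :* u)) :* 𝟘 :+ (z₁ :* 𝟘 :+ z₂ :* (n₂ :* u)) :* (m₂ :* v)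
         := z₂ :+ ((m₂ :* u :- 𝟙) :* z₂ :+ (n₂ :* v :- 𝟙) :* (z₂ :* (m₂ :* u))))
         refl z₁ z₂ m₁ m₂ n₁ n₂ (m₂ ⁻¹) (n₂ ⁻¹)))

  isATP-Smat : ∀ {m₁ m₂ n₁ n₂} → m₂ ≢ 0# → n₂ ≢ 0# → IsATP (σ (Smat (m₁ , m₂) (n₁ , n₂)))
  isATP-Smat {m₁} {m₂} {n₁} {n₂} m₂≢0 n₂≢0 = Smat (m₁ , m₂) (n₁ , n₂) , det≢0 , λ _ → refl
    where
    det≡n₂m₂⁻¹ : det (Smat (m₁ , m₂) (n₁ , n₂)) ≡ n₂ * m₂ ⁻¹
    det≡n₂m₂⁻¹ = solve 3 (λ n₂ u d → 𝟙 :* (n₂ :* u) :- 𝟘 :* d := n₂ :* u) refl n₂ (m₂ ⁻¹) ((n₁ - m₁) * m₂ ⁻¹)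
    det≢0 : det (Smat (m₁ , m₂) (n₁ , n₂)) ≢ 0#
    det≢0 = *-≢0 n₂≢0 (⁻¹-≢0 m₂≢0) ∘ trans (sym det≡n₂m₂⁻¹)

  TR∪ATP : (Point → Point) → Set
  TR∪ATP g = IsTR g ⊎ IsATP g

  Type2-reachable : ∀ ℓ ℓ' → Type2 ℓ → Type2 ℓ' → Reach TR∪ATP ℓ ℓ'
  Type2-reachable (nonvert m@(_ , m₂) k) (nonvert n@(_ , n₂) k') m₂≢0 n₂≢0 = begin
    nonvert m k               ∼⟨ reach-by (inj₂ (isATP-Smat m₂≢0 n₂≢0))
                                   (σ-mapsOnto (Smat-intertwines m₂≢0 n₂≢0) (Smat-intertwines n₂≢0 m₂≢0)
                                     (Smat-inverse m₂≢0 n₂≢0) (Smat-inverse n₂≢0 m₂≢0) k) ⟩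
    nonvert n (k ⋆ Smat m n)  ∼⟨ reach-by (inj₁ (isTR-τ _ _)) (τ-nonvert n (k ⋆ Smat m n) k') ⟩
    nonvert n k'              ∎
    where open ReachReasoning

  Vertical-reachable : ∀ ℓ ℓ' → Vertical ℓ → Vertical ℓ' → Reach TR∪ATP ℓ ℓ'
  Vertical-reachable (vert c) (vert c') _ _ = reach-by (inj₁ (isTR-τ _ _)) (τ-vert c c')

  TR∪LNR : (Point → Point) → Set
  TR∪LNR g = IsTR g ⊎ IsLNR g

  isLNR-λ'1 : ∀ b → IsLNR (λ' 1# b)
  isLNR-λ'1 b = 1# , b , (λ (1≡0 , _) → 1≢0 1≡0) , λ _ → refl

  λ'-type1 : ∀ m x → λ' 1# (r - m) (x , (x ⊗ (m , 0#)) ⊕ 0H) ≡ (0H , (- f m) · x)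
  λ'-type1 m (x₁ , x₂) = trans (cong (λ y → λ' 1# (r - m) ((x₁ , x₂) , y ⊕ 0H)) (⊗-type1 x₁ x₂ m))
    (cong₂ _,_ (cong₂ _,_ (first x₁) (first x₂)) (cong₂ _,_ (second x₁) (second x₂)))
    where
    first : ∀ x → (- (1# * r) + (r - m)) * x + 1# * (x * m + 0#) ≡ 0#
    first x = solve 3 (λ r m x → (:- (𝟙 :* r) :+ (r :- m)) :* x :+ 𝟙 :* (x :* m :+ 𝟘) := 𝟘) refl r m x
    second : ∀ x → 1# * s * x + (r - m) * (x * m + 0#) ≡ - f m * x
    second x = solve 4 (λ r s m x → 𝟙 :* s :* x :+ (r :- m) :* (x :* m :+ 𝟘) := :- fₚ r s m :* x) refl r s m x

  λ'-vertical : ∀ n y → λ' 1# n (0H , y) ≡ (y , (y ⊗ (n , 0#)) ⊕ 0H)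
  λ'-vertical n (y₁ , y₂) = trans
    (cong₂ _,_ (cong₂ _,_ (first y₁) (first y₂)) (cong₂ _,_ (second y₁) (second y₂)))
    (cong (λ z → (y₁ , y₂) , z ⊕ 0H) (sym (⊗-type1 y₁ y₂ n)))
    where
    first : ∀ y → (- (1# * r) + n) * 0# + 1# * y ≡ y
    first y = solve 3 (λ r n y → (:- (𝟙 :* r) :+ n) :* 𝟘 :+ 𝟙 :* y := y) refl r n y
    second : ∀ y → 1# * s * 0# + n * y ≡ y * n + 0#
    second y = solve 3 (λ s n y → 𝟙 :* s :* 𝟘 :+ n :* y := y :* n :+ 𝟘) refl s n y

  λ'-type1-onto-vertical : Irreducible F r s → ∀ m →
                           MapsOnto (λ' 1# (r - m)) (nonvert (m , 0#) 0H) (vert 0H)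
  λ'-type1-onto-vertical irr m =
    mapsOnto {λ' 1# (r - m)} {nonvert (m , 0#) 0H} {vert 0H} h
      (λ { (x , _) refl → cong proj₁ (λ'-type1 m x) })
      (λ _ _ → refl)
      (λ { (_ , y) refl → trans (λ'-type1 m ((c ⁻¹) · y)) (cong (0H ,_) (·-⁻¹-cancel c≢0 y)) })
    where
    c : Carrier
    c = - f m
    c≢0 : c ≢ 0#
    c≢0 = -‿≢0 (f-root-free irr m)
    h : Point → Point
    h (_ , y) = let x = (c ⁻¹) · y in x , (x ⊗ (m , 0#)) ⊕ 0H

  λ'-vertical-onto-type1 : ∀ n → MapsOnto (λ' 1# n) (vert 0H) (nonvert (n , 0#) 0H)
  λ'-vertical-onto-type1 n =
    mapsOnto {λ' 1# n} {vert 0H} {nonvert (n , 0#) 0H} (λ (x , _) → 0H , x)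
      (λ { (_ , y) refl → subst (_∈L nonvert (n , 0#) 0H) (sym (λ'-vertical n y)) refl })
      (λ _ _ → refl)
      (λ { (x , _) refl → λ'-vertical n x })

  BF-reachable : Irreducible F r s → ∀ ℓ ℓ' → BF ℓ → BF ℓ' → Reach TR∪LNR ℓ ℓ'
  BF-reachable irr ℓ ℓ' BFℓ BFℓ' = reach-trans (to-axis ℓ BFℓ) (from-axis ℓ' BFℓ')
    where
    open ReachReasoning
    to-axis : ∀ ℓ → BF ℓ → Reach TR∪LNR ℓ (vert 0H)
    to-axis (nonvert (m , _) k) (inj₁ refl) = begin
      nonvert (m , 0#) k   ∼⟨ reach-by (inj₁ (isTR-τ _ _)) (τ-nonvert (m , 0#) k 0H) ⟩
      nonvert (m , 0#) 0H  ∼⟨ reach-by (inj₂ (isLNR-λ'1 (r - m))) (λ'-type1-onto-vertical irr m) ⟩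
      vert 0H              ∎
    to-axis (vert c) _ = reach-by (inj₁ (isTR-τ _ _)) (τ-vert c 0H)
    from-axis : ∀ ℓ → BF ℓ → Reach TR∪LNR (vert 0H) ℓ
    from-axis (nonvert (n , _) k) (inj₁ refl) = begin
      vert 0H              ∼⟨ reach-by (inj₂ (isLNR-λ'1 n)) (λ'-vertical-onto-type1 n) ⟩
      nonvert (n , 0#) 0H  ∼⟨ reach-by (inj₁ (isTR-τ _ _)) (τ-nonvert (n , 0#) 0H k) ⟩
      nonvert (n , 0#) k   ∎
    from-axis (vert c) _ = reach-by (inj₁ (isTR-τ _ _)) (τ-vert 0H c)

proposition2p4 : (F : FiniteField) (r s : FiniteField.Carrier F) → Irreducible F r s →
    let open Hall F r s in
    (TransitiveOn ⟨TR,ATP⟩ Type2 × TransitiveOn ⟨TR,ATP⟩ Vertical)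
    × TransitiveOn ⟨TR,LNR⟩ BF
proposition2p4 F r s irr =
  (transitiveOn Type2-reachable , transitiveOn Vertical-reachable) , transitiveOn (BF-reachable irr)
  where open HallPlane F r s
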